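{- Work in first-order predicate logic. Let $F$ be a formula such that $\mathsf{CL} \vdash \neg F$ but $\mathsf{IL} \nvdash \neg F$ (such formulas $F$ exist). Then the three sets of formulas \begin{itemize} \item $\mathsf{NF}$, \item $\mathsf{NF} \vee F = \{A \vee F : A \in \mathsf{NF}\}$, \item $\mathsf{NF}[F/\bot] = \{A[F/\bot] : A \in \mathsf{NF}\}$ \end{itemize} are each copies of classical logic in intuitionistic logic, and they are pairwise different (modulo $\mathsf{IL}$).
   Context: Formulas are those of a first-order language with $\bot$, connectives $\wedge,\vee,\to$, quantifiers $\forall,\exists$, and $\neg A$ abbreviating $A \to \bot$; the language contains a unary predicate symbol and a nullary predicate symbol other than $\bot$. $\mathsf{CL}$ denotes classical first-order logic and $\mathsf{IL}$ intuitionistic first-order logic (classical logic without the law of excluded middle). For a set $\Gamma$ of formulas, $\mathsf{CL}+\Gamma \vdash A$ means $A$ is provable in $\mathsf{CL}$ from assumptions $\Gamma$, similarly for $\mathsf{IL}$. A negative translation is a map $N$ from formulas to formulas such that (i) for all formulas $A$ and sets $\Gamma$ of formulas, $\mathsf{CL}+\Gamma \vdash A$ implies $\mathsf{IL} + \{N(B) : B \in \Gamma\} \vdash N(A)$, and (ii) for all formulas $A$, $\mathsf{CL} \vdash A \leftrightarrow N(A)$. A copy of classical logic in intuitionistic logic is the image $\operatorname{im} N = \{N(A) : A \text{ a formula}\}$ of some negative translation $N$. Sets of formulas are compared modulo $\mathsf{IL}$: two sets $S, T$ are equal if every formula of $S$ is $\mathsf{IL}$-provably equivalent to some formula of $T$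 and vice versa. The negative fragment $\mathsf{NF}$ is (essentially) the set of formulas without $\vee$ and $\exists$; precisely, the formulas built from $\bot$ and double-negated atomic formulas $\neg\neg P$ by $\wedge$, $\to$, $\forall$ (this is, modulo $\mathsf{IL}$, the image of Kolmogorov's translation, which double negates every subformula). $A[F/\bot]$ denotes the result of replacing every occurrence of $\bot$ in $A$ by $F$. -}

module Defs where

open import Data.Nat using (ℕ; zero; suc)
open import Data.Vec using (Vec; []; _∷_)
open import Data.Bool using (Bool; true; false)
open import Data.Product using (Σ; ∃; _×_; _,_)
open import Data.Sum using (_⊎_)
open import Data.Empty using (⊥)
open import Relation.Binary.PropositionalEquality using (_≡_)
open import Relation.Nullary using (¬_)

-- A first-order language (signature): function symbols and predicate
-- symbols with arities.  ⊥ is a logical constant, not a predicate symbol.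
-- No equality symbol is built in.

record Language : Set₁ where
  field
    Fun    : Set
    funAr  : Fun → ℕ
    Rel    : Set
    relAr  : Rel → ℕ

module FOL (L : Language) where
  open Language L

  data Term : Set where
    var : ℕ → Term
    fun : (f : Fun) → Vec Term (funAr f) → Term

  infixr 6 _∧'_
  infixr 5 _∨'_
  infixr 4 _⇒_

  -- Formulas (possibly open).  ∀' and ∃' bind de Bruijn index 0.
  data Formula : Set where
    ⊥'    : Formula
    atom  : (p : Rel) → Vec Term (relAr p) → Formula
    _∧'_  : Formula → Formula → Formula
    _∨'_  : Formula → Formula → Formula
    _⇒_   : Formula → Formula → Formula
    ∀'    : Formula → Formula
    ∃'    : Formula → Formula

  neg : Formula → Formula
  neg A = A ⇒ ⊥'

  _⇔'_ : Formula → Formula → Formula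
  A ⇔' B = (A ⇒ B) ∧' (B ⇒ A)

  Subst : Set
  Subst = ℕ → Term

  mutual
    substT : Subst → Term → Term
    substT σ (var x)    = σ x
    substT σ (fun f ts) = fun f (substTs σ ts)

    substTs : ∀ {n} → Subst → Vec Term n → Vec Term n
    substTs σ []       = []
    substTs σ (t ∷ ts) = substT σ t ∷ substTs σ ts

  shiftT : Term → Term
  shiftT = substT (λ x → var (suc x))

  exts : Subst → Subst
  exts σ zero    = var zero
  exts σ (suc x) = shiftT (σ x)

  substF : Subst → Formula → Formula
  substF σ ⊥'         = ⊥'
  substF σ (atom p ts) = atom p (substTs σ ts)
  substF σ (A ∧' B)   = substF σ A ∧' substF σ B
  substF σ (A ∨' B)   = substF σ A ∨' substF σ B
  substF σ (A ⇒ B)    = substF σ A ⇒ substF σ B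
  substF σ (∀' A)     = ∀' (substF (exts σ) A)
  substF σ (∃' A)     = ∃' (substF (exts σ) A)

  shift : Formula → Formula
  shift = substF (λ x → var (suc x))

  single : Term → Subst
  single t zero    = t
  single t (suc x) = var x

  _[_] : Formula → Term → Formula
  A [ t ] = substF (single t) A

  FSet : Set₁
  FSet = Formula → Set

  ∅ : FSet
  ∅ _ = ⊥

  _,,_ : FSet → Formula → FSet
  (Γ ,, A) B = Γ B ⊎ B ≡ A

  ↑ : FSet → FSet
  ↑ Γ B = ∃ λ C → Γ C × B ≡ shift C

  image : (Formula → Formula) → FSet → FSet
  image N Γ B = ∃ λ C → Γ C × B ≡ N C

  data Deriv (classical : Bool) : FSet → Formula → Set₁ where
    assum : ∀ {Γ A} → Γ A → Deriv classical Γ A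
    ⊥E    : ∀ {Γ A} → Deriv classical Γ ⊥' → Deriv classical Γ A
    ∧I    : ∀ {Γ A B} → Deriv classical Γ A → Deriv classical Γ B → Deriv classical Γ (A ∧' B)
    ∧E₁   : ∀ {Γ A B} → Deriv classical Γ (A ∧' B) → Deriv classical Γ A
    ∧E₂   : ∀ {Γ A B} → Deriv classical Γ (A ∧' B) → Deriv classical Γ B
    ∨I₁   : ∀ {Γ A B} → Deriv classical Γ A → Deriv classical Γ (A ∨' B)
    ∨I₂   : ∀ {Γ A B} → Deriv classical Γ B → Deriv classical Γ (A ∨' B)
    ∨E    : ∀ {Γ A B C} → Deriv classical Γ (A ∨' B) →
            Deriv classical (Γ ,, A) C → Deriv classical (Γ ,, B) C →
            Deriv classical Γ C
    ⇒I    : ∀ {Γ A B} → Deriv classical (Γ ,, A) B → Deriv classical Γ (A ⇒ B)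
    ⇒E    : ∀ {Γ A B} → Deriv classical Γ (A ⇒ B) → Deriv classical Γ A → Deriv classical Γ B
    ∀I    : ∀ {Γ A} → Deriv classical (↑ Γ) A → Deriv classical Γ (∀' A)
    ∀E    : ∀ {Γ A} → Deriv classical Γ (∀' A) → (t : Term) → Deriv classical Γ (A [ t ])
    ∃I    : ∀ {Γ A} (t : Term) → Deriv classical Γ (A [ t ]) → Deriv classical Γ (∃' A)
    ∃E    : ∀ {Γ A C} → Deriv classical Γ (∃' A) →
            Deriv classical (↑ Γ ,, A) (shift C) → Deriv classical Γ C
    lem   : ∀ {Γ A} → classical ≡ true → Deriv classical Γ (A ∨' neg A)

  CL_⊢_ : FSet → Formula → Set₁
  CL Γ ⊢ A = Deriv true Γ A

  IL_⊢_ : FSet → Formula → Set₁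
  IL Γ ⊢ A = Deriv false Γ A

  record NegativeTranslation (N : Formula → Formula) : Set₁ where
    field
      preserves : ∀ (Γ : FSet) (A : Formula) → CL Γ ⊢ A → IL (image N Γ) ⊢ N A
      classEquiv : ∀ (A : Formula) → CL ∅ ⊢ (A ⇔' N A)

  im : (Formula → Formula) → FSet
  im N B = ∃ λ A → B ≡ N A

  _≈IL_ : FSet → FSet → Set₁
  S ≈IL T = (∀ A → S A → Σ Formula λ B → T B × IL ∅ ⊢ (A ⇔' B))
          × (∀ B → T B → Σ Formula λ A → S A × IL ∅ ⊢ (A ⇔' B))

  IsCopyOfCL : FSet → Set₁
  IsCopyOfCL S = Σ (Formula → Formula) λ N → NegativeTranslation N × (S ≈IL im N)

  data NF : FSet where
    nf⊥   : NF ⊥'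
    nfAt  : ∀ p ts → NF (neg (neg (atom p ts)))
    nf∧   : ∀ {A B} → NF A → NF B → NF (A ∧' B)
    nf⇒   : ∀ {A B} → NF A → NF B → NF (A ⇒ B)
    nf∀   : ∀ {A} → NF A → NF (∀' A)

  -- A[F/⊥]: replace every ⊥ by F (capture-avoiding: F is shifted under binders)
  _[_/⊥] : Formula → Formula → Formula
  ⊥'         [ F /⊥] = F
  atom p ts  [ F /⊥] = atom p ts
  (A ∧' B)   [ F /⊥] = (A [ F /⊥]) ∧' (B [ F /⊥])
  (A ∨' B)   [ F /⊥] = (A [ F /⊥]) ∨' (B [ F /⊥])
  (A ⇒ B)    [ F /⊥] = (A [ F /⊥]) ⇒ (B [ F /⊥])
  ∀' A       [ F /⊥] = ∀' (A [ shift F /⊥])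
  ∃' A       [ F /⊥] = ∃' (A [ shift F /⊥])

  NF∨ : Formula → FSet
  NF∨ F B = ∃ λ A → NF A × B ≡ (A ∨' F)

  NF[_/⊥] : Formula → FSet
  NF[ F /⊥] B = ∃ λ A → NF A × B ≡ (A [ F /⊥])

-- The Gödel–Gentzen translation gg, with F read for ⊥, sends classical derivations to
-- intuitionistic ones whatever F is (Friedman), and on the negative fragment A[F/⊥] and
-- gg(A)[F/⊥] are intuitionistically equivalent.  If CL ⊢ ¬F, both A ↦ gg(A)[F/⊥] and
-- A ↦ gg(A) ∨ F are classically the identity; the second preserves derivability because a
-- derivation uses only finitely many hypotheses B ∨ F, each of which can be split by ∨E.
-- Hence NF, NF[F/⊥] and NF ∨ F are copies of classical logic.
--
-- If NF = NF ∨ F, then ⊥ ↔ A ∨ F for some A, so IL ⊢ ¬F.  If NF = NF[F/⊥], then F ↔ A for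
-- some negative A; ¬A is negative and classically valid, hence intuitionistically valid
-- (a negative formula is intuitionistically equivalent to its Gödel–Gentzen translation), so
-- again IL ⊢ ¬F.  The last pair is separated with Kleene's slash.
--
-- A witness for F is ¬∀x(Px ∨ ¬Px): it is not intuitionistically refutable in a Kripke
-- model where P grows along the worlds.

module Submission where

open import Defs
open import Data.Nat using (ℕ; zero; suc; _≤_; _<_; z≤n)
open import Data.Nat.Properties using (≤-refl; ≤-trans; <-≤-trans; <-irrefl; n<1+n; n≤1+n)
open import Data.Vec using (Vec; []; _∷_)
open import Data.Bool using (Bool; true; false; T; not; _∧_; _∨_)
open import Data.Bool.Properties using (T-∧; T-∨)
open import Data.Unit using (tt)
open import Data.List using (List; []; _∷_; _++_)
open import Data.List.Membership.Propositional using (_∈_)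
open import Data.List.Membership.Propositional.Properties using (∈-++⁺ˡ; ∈-++⁺ʳ)
open import Data.List.Relation.Unary.All as All using (All; []; _∷_)
open import Data.List.Relation.Unary.All.Properties using (++⁺)
open import Data.List.Relation.Unary.Any using (here; there)
open import Data.Product using (Σ; ∃; _×_; _,_; proj₁; proj₂)
open import Data.Sum using (_⊎_; inj₁; inj₂; [_,_])
open import Data.Empty using (⊥; ⊥-elim)
open import Function using (_∘_; _⇔_; mk⇔; Equivalence)
open import Level using (Lift)
open import Relation.Binary.PropositionalEquality using (_≡_; _≗_; refl; sym; trans; cong; cong₂; subst)
open import Relation.Nullary using (¬_)

module _ (L : Language) where
  open Language L
  open FOL L

  _⊆_ : FSet → FSet → Set
  Γ ⊆ Δ = ∀ B → Γ B → Δ B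

  mutual
    substT-cong : ∀ {σ τ} → σ ≗ τ → ∀ t → substT σ t ≡ substT τ t
    substT-cong e (var x)    = e x
    substT-cong e (fun f ts) = cong (fun f) (substTs-cong e ts)

    substTs-cong : ∀ {σ τ n} → σ ≗ τ → (ts : Vec Term n) → substTs σ ts ≡ substTs τ ts
    substTs-cong e []       = refl
    substTs-cong e (t ∷ ts) = cong₂ _∷_ (substT-cong e t) (substTs-cong e ts)

  exts-cong : ∀ {σ τ} → σ ≗ τ → exts σ ≗ exts τ
  exts-cong e zero    = refl
  exts-cong e (suc x) = cong shiftT (e x)

  substF-cong : ∀ {σ τ} → σ ≗ τ → ∀ A → substF σ A ≡ substF τ A
  substF-cong e ⊥'          = refl
  substF-cong e (atom p ts) = cong (atom p) (substTs-cong e ts)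
  substF-cong e (A ∧' B)    = cong₂ _∧'_ (substF-cong e A) (substF-cong e B)
  substF-cong e (A ∨' B)    = cong₂ _∨'_ (substF-cong e A) (substF-cong e B)
  substF-cong e (A ⇒ B)     = cong₂ _⇒_ (substF-cong e A) (substF-cong e B)
  substF-cong e (∀' A)      = cong ∀' (substF-cong (exts-cong e) A)
  substF-cong e (∃' A)      = cong ∃' (substF-cong (exts-cong e) A)

  infixr 9 _⊙_
  _⊙_ : Subst → Subst → Subst
  (τ ⊙ σ) x = substT τ (σ x)

  ↑ₛ : Subst
  ↑ₛ x = var (suc x)

  mutual
    substT-⊙ : ∀ τ σ t → substT τ (substT σ t) ≡ substT (τ ⊙ σ) t
    substT-⊙ τ σ (var x)    = refl
    substT-⊙ τ σ (fun f ts) = cong (fun f) (substTs-⊙ τ σ ts)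

    substTs-⊙ : ∀ {n} τ σ (ts : Vec Term n) → substTs τ (substTs σ ts) ≡ substTs (τ ⊙ σ) ts
    substTs-⊙ τ σ []       = refl
    substTs-⊙ τ σ (t ∷ ts) = cong₂ _∷_ (substT-⊙ τ σ t) (substTs-⊙ τ σ ts)

  exts-⊙ : ∀ τ σ → exts τ ⊙ exts σ ≗ exts (τ ⊙ σ)
  exts-⊙ τ σ zero    = refl
  exts-⊙ τ σ (suc x) = trans (substT-⊙ (exts τ) ↑ₛ (σ x)) (sym (substT-⊙ ↑ₛ τ (σ x)))

  substF-⊙ : ∀ τ σ A → substF τ (substF σ A) ≡ substF (τ ⊙ σ) A
  substF-⊙ τ σ ⊥'          = refl
  substF-⊙ τ σ (atom p ts) = cong (atom p) (substTs-⊙ τ σ ts)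
  substF-⊙ τ σ (A ∧' B)    = cong₂ _∧'_ (substF-⊙ τ σ A) (substF-⊙ τ σ B)
  substF-⊙ τ σ (A ∨' B)    = cong₂ _∨'_ (substF-⊙ τ σ A) (substF-⊙ τ σ B)
  substF-⊙ τ σ (A ⇒ B)     = cong₂ _⇒_ (substF-⊙ τ σ A) (substF-⊙ τ σ B)
  substF-⊙ τ σ (∀' A)      = cong ∀' (trans (substF-⊙ (exts τ) (exts σ) A) (substF-cong (exts-⊙ τ σ) A))
  substF-⊙ τ σ (∃' A)      = cong ∃' (trans (substF-⊙ (exts τ) (exts σ) A) (substF-cong (exts-⊙ τ σ) A))

  mutual
    substT-id : ∀ t → substT var t ≡ t
    substT-id (var x)    = refl
    substT-id (fun f ts) = cong (fun f) (substTs-id ts)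

    substTs-id : ∀ {n} (ts : Vec Term n) → substTs var ts ≡ ts
    substTs-id []       = refl
    substTs-id (t ∷ ts) = cong₂ _∷_ (substT-id t) (substTs-id ts)

  exts-var : ∀ {σ} → σ ≗ var → exts σ ≗ var
  exts-var e zero    = refl
  exts-var e (suc x) = cong shiftT (e x)

  substF-id′ : ∀ {σ} → σ ≗ var → ∀ A → substF σ A ≡ A
  substF-id′ e ⊥'          = refl
  substF-id′ e (atom p ts) = cong (atom p) (trans (substTs-cong e ts) (substTs-id ts))
  substF-id′ e (A ∧' B)    = cong₂ _∧'_ (substF-id′ e A) (substF-id′ e B)
  substF-id′ e (A ∨' B)    = cong₂ _∨'_ (substF-id′ e A) (substF-id′ e B)
  substF-id′ e (A ⇒ B)     = cong₂ _⇒_ (substF-id′ e A) (substF-id′ e B)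
  substF-id′ e (∀' A)      = cong ∀' (substF-id′ (exts-var e) A)
  substF-id′ e (∃' A)      = cong ∃' (substF-id′ (exts-var e) A)

  substF-id : ∀ A → substF var A ≡ A
  substF-id = substF-id′ (λ _ → refl)

  _∷ₛ_ : Term → Subst → Subst
  (t ∷ₛ σ) zero    = t
  (t ∷ₛ σ) (suc x) = σ x

  ∷ₛ-cong : ∀ {σ τ} t → σ ≗ τ → t ∷ₛ σ ≗ t ∷ₛ τ
  ∷ₛ-cong t e zero    = refl
  ∷ₛ-cong t e (suc x) = e x

  ∷ₛ-⊙-exts : ∀ t σ τ → (t ∷ₛ σ) ⊙ exts τ ≗ t ∷ₛ (σ ⊙ τ)
  ∷ₛ-⊙-exts t σ τ zero    = refl
  ∷ₛ-⊙-exts t σ τ (suc x) = substT-⊙ (t ∷ₛ σ) ↑ₛ (τ x)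

  single-⊙ : ∀ σ t → σ ⊙ single t ≗ substT σ t ∷ₛ σ
  single-⊙ σ t zero    = refl
  single-⊙ σ t (suc x) = refl

  exts-inst : ∀ σ A t → (substF (exts σ) A) [ t ] ≡ substF (t ∷ₛ σ) A
  exts-inst σ A t = trans (substF-⊙ (single t) (exts σ) A) (substF-cong single-⊙-exts A)
    where
      single-⊙-exts : single t ⊙ exts σ ≗ t ∷ₛ σ
      single-⊙-exts zero    = refl
      single-⊙-exts (suc x) = trans (substT-⊙ (single t) ↑ₛ (σ x)) (substT-id (σ x))

  shift-inst : ∀ t A → (shift A) [ t ] ≡ A
  shift-inst t A = trans (substF-⊙ (single t) ↑ₛ A) (substF-id A)

  exts-↑-inst₀ : ∀ A → (substF (exts ↑ₛ) A) [ var zero ] ≡ A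
  exts-↑-inst₀ A = trans (exts-inst ↑ₛ A (var zero)) (substF-id′ var₀∷↑ A)
    where
      var₀∷↑ : var zero ∷ₛ ↑ₛ ≗ var
      var₀∷↑ zero    = refl
      var₀∷↑ (suc x) = refl

  substF-inst : ∀ σ A t → substF σ (A [ t ]) ≡ (substF (exts σ) A) [ substT σ t ]
  substF-inst σ A t =
    trans (substF-⊙ σ (single t) A)
          (trans (substF-cong (single-⊙ σ t) A) (sym (exts-inst σ A (substT σ t))))

  substF-shift : ∀ σ A → substF (exts σ) (shift A) ≡ shift (substF σ A)
  substF-shift σ A = trans (substF-⊙ (exts σ) ↑ₛ A) (sym (substF-⊙ ↑ₛ σ A))

  ,,-mono : ∀ {Γ Δ A} → Γ ⊆ Δ → (Γ ,, A) ⊆ (Δ ,, A)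
  ,,-mono s B (inj₁ x) = inj₁ (s B x)
  ,,-mono s B (inj₂ e) = inj₂ e

  ↑-mono : ∀ {Γ Δ} → Γ ⊆ Δ → ↑ Γ ⊆ ↑ Δ
  ↑-mono s B (C , g , e) = C , s C g , e

  weaken : ∀ {c Γ Δ A} → Γ ⊆ Δ → Deriv c Γ A → Deriv c Δ A
  weaken s (assum x)    = assum (s _ x)
  weaken s (⊥E d)       = ⊥E (weaken s d)
  weaken s (∧I d e)     = ∧I (weaken s d) (weaken s e)
  weaken s (∧E₁ d)      = ∧E₁ (weaken s d)
  weaken s (∧E₂ d)      = ∧E₂ (weaken s d)
  weaken s (∨I₁ d)      = ∨I₁ (weaken s d)
  weaken s (∨I₂ d)      = ∨I₂ (weaken s d)
  weaken s (∨E d e f)   = ∨E (weaken s d) (weaken (,,-mono s) e) (weaken (,,-mono s) f)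
  weaken s (⇒I d)       = ⇒I (weaken (,,-mono s) d)
  weaken s (⇒E d e)     = ⇒E (weaken s d) (weaken s e)
  weaken s (∀I d)       = ∀I (weaken (↑-mono s) d)
  weaken s (∀E d t)     = ∀E (weaken s d) t
  weaken s (∃I t d)     = ∃I t (weaken s d)
  weaken s (∃E d e)     = ∃E (weaken s d) (weaken (,,-mono (↑-mono s)) e)
  weaken s (lem x)      = lem x

  wk : ∀ {c Γ A B} → Deriv c Γ A → Deriv c (Γ ,, B) A
  wk = weaken (λ _ → inj₁)

  hyp : ∀ {c Γ A} → Deriv c (Γ ,, A) A
  hyp = assum (inj₂ refl)

  weaken-∅ : ∀ {c Γ A} → Deriv c ∅ A → Deriv c Γ A
  weaken-∅ = weaken (λ _ ())

  castD : ∀ {c Γ A B} → A ≡ B → Deriv c Γ A → Deriv c Γ B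
  castD refl d = d

  ⇔I : ∀ {c Γ A B} → Deriv c (Γ ,, A) B → Deriv c (Γ ,, B) A → Deriv c Γ (A ⇔' B)
  ⇔I d e = ∧I (⇒I d) (⇒I e)

  ⇔-refl : ∀ {c Γ A} → Deriv c Γ (A ⇔' A)
  ⇔-refl = ⇔I hyp hyp

  ⇔-to : ∀ {c Γ A B} → Deriv c ∅ (A ⇔' B) → Deriv c Γ A → Deriv c Γ B
  ⇔-to e = ⇒E (∧E₁ (weaken-∅ e))

  ⇔-from : ∀ {c Γ A B} → Deriv c ∅ (A ⇔' B) → Deriv c Γ B → Deriv c Γ A
  ⇔-from e = ⇒E (∧E₂ (weaken-∅ e))

  ∨-congʳ : ∀ {c A B F} → Deriv c ∅ (A ⇔' B) → Deriv c ∅ ((A ∨' F) ⇔' (B ∨' F))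
  ∨-congʳ e = ⇔I (∨E hyp (∨I₁ (⇔-to e hyp)) (∨I₂ hyp)) (∨E hyp (∨I₁ (⇔-from e hyp)) (∨I₂ hyp))

  image-,, : ∀ N {Γ A} → image N (Γ ,, A) ⊆ (image N Γ ,, N A)
  image-,, N B (C , inj₁ g , e)    = inj₁ (C , g , e)
  image-,, N B (C , inj₂ refl , e) = inj₂ e

  image-↑ : ∀ σ {Γ} → image (substF (exts σ)) (↑ Γ) ⊆ ↑ (image (substF σ) Γ)
  image-↑ σ B (_ , (C , g , refl) , refl) = substF σ C , (C , g , refl) , substF-shift σ C

  substDeriv : ∀ {c Γ A} σ → Deriv c Γ A → Deriv c (image (substF σ) Γ) (substF σ A)
  substDeriv σ (assum x)  = assum (_ , x , refl)
  substDeriv σ (⊥E d)     = ⊥E (substDeriv σ d)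
  substDeriv σ (∧I d e)   = ∧I (substDeriv σ d) (substDeriv σ e)
  substDeriv σ (∧E₁ d)    = ∧E₁ (substDeriv σ d)
  substDeriv σ (∧E₂ d)    = ∧E₂ (substDeriv σ d)
  substDeriv σ (∨I₁ d)    = ∨I₁ (substDeriv σ d)
  substDeriv σ (∨I₂ d)    = ∨I₂ (substDeriv σ d)
  substDeriv σ (∨E d e f) =
    ∨E (substDeriv σ d) (weaken (image-,, (substF σ)) (substDeriv σ e))
                        (weaken (image-,, (substF σ)) (substDeriv σ f))
  substDeriv σ (⇒I d)     = ⇒I (weaken (image-,, (substF σ)) (substDeriv σ d))
  substDeriv σ (⇒E d e)   = ⇒E (substDeriv σ d) (substDeriv σ e)
  substDeriv σ (∀I d)     = ∀I (weaken (image-↑ σ) (substDeriv (exts σ) d))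
  substDeriv σ (∀E {A = A} d t) = castD (sym (substF-inst σ A t)) (∀E (substDeriv σ d) (substT σ t))
  substDeriv σ (∃I {A = A} t d) = ∃I (substT σ t) (castD (substF-inst σ A t) (substDeriv σ d))
  substDeriv σ (∃E {C = C} d e) =
    ∃E (substDeriv σ d)
       (castD (substF-shift σ C)
              (weaken (λ B → ,,-mono (image-↑ σ) B ∘ image-,, (substF (exts σ)) B) (substDeriv (exts σ) e)))
  substDeriv σ (lem x)    = lem x

  shiftDeriv : ∀ {c Γ A} → Deriv c Γ A → Deriv c (↑ Γ) (shift A)
  shiftDeriv = substDeriv ↑ₛ

  ∀E-shift₀ : ∀ {c Γ A} → Deriv c Γ (shift (∀' A)) → Deriv c Γ A
  ∀E-shift₀ {A = A} d = castD (exts-↑-inst₀ A) (∀E d (var zero))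

  ∀E₀ : ∀ {c Γ A} → Deriv c Γ (∀' A) → Deriv c (↑ Γ) A
  ∀E₀ = ∀E-shift₀ ∘ shiftDeriv

  cut-,, : ∀ {c Γ Δ A} → (∀ B → Γ B → Deriv c Δ B) → ∀ B → (Γ ,, A) B → Deriv c (Δ ,, A) B
  cut-,, h B (inj₁ x)    = wk (h B x)
  cut-,, h B (inj₂ refl) = hyp

  cut : ∀ {c Γ Δ A} → Deriv c Γ A → (∀ B → Γ B → Deriv c Δ B) → Deriv c Δ A
  cut (assum x)  h = h _ x
  cut (⊥E d)     h = ⊥E (cut d h)
  cut (∧I d e)   h = ∧I (cut d h) (cut e h)
  cut (∧E₁ d)    h = ∧E₁ (cut d h)
  cut (∧E₂ d)    h = ∧E₂ (cut d h)
  cut (∨I₁ d)    h = ∨I₁ (cut d h)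
  cut (∨I₂ d)    h = ∨I₂ (cut d h)
  cut (∨E d e f) h = ∨E (cut d h) (cut e (cut-,, h)) (cut f (cut-,, h))
  cut (⇒I d)     h = ⇒I (cut d (cut-,, h))
  cut (⇒E d e)   h = ⇒E (cut d h) (cut e h)
  cut (∀I d)     h = ∀I (cut d λ { B (C , g , refl) → shiftDeriv (h C g) })
  cut (∀E d t)   h = ∀E (cut d h) t
  cut (∃I t d)   h = ∃I t (cut d h)
  cut (∃E d e)   h = ∃E (cut d h) (cut e (cut-,, λ { B (C , g , refl) → shiftDeriv (h C g) }))
  cut (lem x)    h = lem x

  IL⇒CL : ∀ {Γ A} → IL Γ ⊢ A → CL Γ ⊢ A
  IL⇒CL (assum x)  = assum x
  IL⇒CL (⊥E d)     = ⊥E (IL⇒CL d)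
  IL⇒CL (∧I d e)   = ∧I (IL⇒CL d) (IL⇒CL e)
  IL⇒CL (∧E₁ d)    = ∧E₁ (IL⇒CL d)
  IL⇒CL (∧E₂ d)    = ∧E₂ (IL⇒CL d)
  IL⇒CL (∨I₁ d)    = ∨I₁ (IL⇒CL d)
  IL⇒CL (∨I₂ d)    = ∨I₂ (IL⇒CL d)
  IL⇒CL (∨E d e f) = ∨E (IL⇒CL d) (IL⇒CL e) (IL⇒CL f)
  IL⇒CL (⇒I d)     = ⇒I (IL⇒CL d)
  IL⇒CL (⇒E d e)   = ⇒E (IL⇒CL d) (IL⇒CL e)
  IL⇒CL (∀I d)     = ∀I (IL⇒CL d)
  IL⇒CL (∀E d t)   = ∀E (IL⇒CL d) t
  IL⇒CL (∃I t d)   = ∃I t (IL⇒CL d)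
  IL⇒CL (∃E d e)   = ∃E (IL⇒CL d) (IL⇒CL e)
  IL⇒CL (lem ())

  ⊆-trans : ∀ {Γ Δ Θ} → Γ ⊆ Δ → Δ ⊆ Θ → Γ ⊆ Θ
  ⊆-trans s r B = r B ∘ s B

  listSet : List Formula → FSet
  listSet ls B = B ∈ ls

  ⊆-++ˡ : ∀ ls ms → listSet ls ⊆ listSet (ls ++ ms)
  ⊆-++ˡ ls ms B = ∈-++⁺ˡ

  ⊆-++ʳ : ∀ ls ms → listSet ms ⊆ listSet (ls ++ ms)
  ⊆-++ʳ ls ms B = ∈-++⁺ʳ ls

  FinitelyDerivable : Bool → FSet → Formula → Set₁
  FinitelyDerivable c Γ A = Σ (List Formula) λ ls → All Γ ls × Deriv c (listSet ls) A

  finite-map : ∀ {c Γ A B} → (∀ {Δ} → Deriv c Δ A → Deriv c Δ B) →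
               FinitelyDerivable c Γ A → FinitelyDerivable c Γ B
  finite-map f (ls , a , d) = ls , a , f d

  finite-map₂ : ∀ {c Γ A B C} → (∀ {Δ} → Deriv c Δ A → Deriv c Δ B → Deriv c Δ C) →
                FinitelyDerivable c Γ A → FinitelyDerivable c Γ B → FinitelyDerivable c Γ C
  finite-map₂ f (ls , a , d) (ms , b , e) =
    ls ++ ms , ++⁺ a b , f (weaken (⊆-++ˡ ls ms) d) (weaken (⊆-++ʳ ls ms) e)

  drop-,, : ∀ {Γ A} ls → All (Γ ,, A) ls → Σ (List Formula) λ ms → All Γ ms × listSet ls ⊆ (listSet ms ,, A)
  drop-,, [] [] = [] , [] , λ _ ()
  drop-,, (B ∷ ls) (inj₁ g ∷ a) with drop-,, ls a
  ... | ms , b , s = B ∷ ms , g ∷ b , λ { _ (here refl) → inj₁ (here refl)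
                                        ; C (there x) → ,,-mono {Δ = listSet (B ∷ ms)} (λ _ → there) C (s C x) }
  drop-,, (B ∷ ls) (inj₂ refl ∷ a) with drop-,, ls a
  ... | ms , b , s = ms , b , λ { _ (here refl) → inj₂ refl ; C (there x) → s C x }

  unshift : ∀ {Γ} ls → All (↑ Γ) ls → Σ (List Formula) λ ms → All Γ ms × listSet ls ⊆ ↑ (listSet ms)
  unshift [] [] = [] , [] , λ _ ()
  unshift (_ ∷ ls) ((C , g , refl) ∷ a) with unshift ls a
  ... | ms , b , s = C ∷ ms , g ∷ b , λ { _ (here refl) → C , here refl , refl
                                        ; B (there x) → ↑-mono {Δ = listSet (C ∷ ms)} (λ _ → there) B (s B x) }

  discharge : ∀ {c Γ A B} → FinitelyDerivable c (Γ ,, A) B →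
              Σ (List Formula) λ ms → All Γ ms × Deriv c (listSet ms ,, A) B
  discharge (ls , a , d) with drop-,, ls a
  ... | ms , b , s = ms , b , weaken s d

  finiteSupport : ∀ {c Γ A} → Deriv c Γ A → FinitelyDerivable c Γ A
  finiteSupport {A = A} (assum x) = A ∷ [] , x ∷ [] , assum (here refl)
  finiteSupport (⊥E d)      = finite-map ⊥E (finiteSupport d)
  finiteSupport (∧I d e)    = finite-map₂ ∧I (finiteSupport d) (finiteSupport e)
  finiteSupport (∧E₁ d)     = finite-map ∧E₁ (finiteSupport d)
  finiteSupport (∧E₂ d)     = finite-map ∧E₂ (finiteSupport d)
  finiteSupport (∨I₁ d)     = finite-map ∨I₁ (finiteSupport d)
  finiteSupport (∨I₂ d)     = finite-map ∨I₂ (finiteSupport d)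
  finiteSupport (∨E d e f)
    with finiteSupport d | discharge (finiteSupport e) | discharge (finiteSupport f)
  ... | ls , a , d′ | ms , b , e′ | ns , c , f′ =
    ls ++ ms ++ ns , ++⁺ a (++⁺ b c) ,
    ∨E (weaken (⊆-++ˡ ls _) d′)
       (weaken (,,-mono (⊆-trans (⊆-++ˡ ms ns) (⊆-++ʳ ls _))) e′)
       (weaken (,,-mono (⊆-trans (⊆-++ʳ ms ns) (⊆-++ʳ ls _))) f′)
  finiteSupport (⇒I d) with discharge (finiteSupport d)
  ... | ms , b , d′ = ms , b , ⇒I d′
  finiteSupport (⇒E d e)    = finite-map₂ ⇒E (finiteSupport d) (finiteSupport e)
  finiteSupport (∀I d) with finiteSupport d
  ... | ls , a , d′ with unshift ls a
  ... | ms , b , s = ms , b , ∀I (weaken s d′)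
  finiteSupport (∀E d t)    = finite-map (λ d′ → ∀E d′ t) (finiteSupport d)
  finiteSupport (∃I t d)    = finite-map (∃I t) (finiteSupport d)
  finiteSupport (∃E d e) with finiteSupport d | discharge (finiteSupport e)
  ... | ls , a , d′ | ms , b , e′ with unshift ms b
  ... | ns , c , s =
    ls ++ ns , ++⁺ a c ,
    ∃E (weaken (⊆-++ˡ ls ns) d′) (weaken (,,-mono (⊆-trans s (↑-mono (⊆-++ʳ ls ns)))) e′)
  finiteSupport (lem x)     = [] , [] , lem x

  _∪ₗ_ : FSet → List Formula → FSet
  (Δ ∪ₗ ls) B = Δ B ⊎ B ∈ ls

  ∨ʳ-hyps-list : ∀ {Δ A} F ls → All (λ B → Δ (B ∨' F)) ls → IL (Δ ∪ₗ ls) ⊢ A → IL Δ ⊢ (A ∨' F)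
  ∨ʳ-hyps-list F []       []       d = ∨I₁ (weaken (λ { _ (inj₁ x) → x ; _ (inj₂ ()) }) d)
  ∨ʳ-hyps-list F (B ∷ ls) (h ∷ hs) d =
    ∨E (assum h)
       (∨ʳ-hyps-list F ls (All.map inj₁ hs)
          (weaken (λ { _ (inj₁ x) → inj₁ (inj₁ x) ; _ (inj₂ (here refl)) → inj₁ (inj₂ refl)
                     ; _ (inj₂ (there x)) → inj₂ x }) d))
       (∨I₂ hyp)

  -- Needs finite support: ∨E can case-split on only finitely many hypotheses B ∨ F.
  ∨ʳ-hyps : ∀ {Γ A} F → IL Γ ⊢ A → IL image (_∨' F) Γ ⊢ (A ∨' F)
  ∨ʳ-hyps F d with finiteSupport d
  ... | ls , a , d′ = ∨ʳ-hyps-list F ls (All.map (λ g → _ , g , refl) a) (weaken (λ _ → inj₂) d′)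

  -- The Gödel–Gentzen translation with F read for ⊥

  substF-[/⊥] : ∀ σ A F → substF σ (A [ F /⊥]) ≡ (substF σ A) [ substF σ F /⊥]
  substF-[/⊥] σ ⊥'          F = refl
  substF-[/⊥] σ (atom p ts) F = refl
  substF-[/⊥] σ (A ∧' B)    F = cong₂ _∧'_ (substF-[/⊥] σ A F) (substF-[/⊥] σ B F)
  substF-[/⊥] σ (A ∨' B)    F = cong₂ _∨'_ (substF-[/⊥] σ A F) (substF-[/⊥] σ B F)
  substF-[/⊥] σ (A ⇒ B)     F = cong₂ _⇒_ (substF-[/⊥] σ A F) (substF-[/⊥] σ B F)
  substF-[/⊥] σ (∀' A)      F =
    cong ∀' (trans (substF-[/⊥] (exts σ) A (shift F)) (cong (substF (exts σ) A [_/⊥]) (substF-shift σ F)))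
  substF-[/⊥] σ (∃' A)      F =
    cong ∃' (trans (substF-[/⊥] (exts σ) A (shift F)) (cong (substF (exts σ) A [_/⊥]) (substF-shift σ F)))

  [⊥/⊥]-id : ∀ A → A [ ⊥' /⊥] ≡ A
  [⊥/⊥]-id ⊥'          = refl
  [⊥/⊥]-id (atom p ts) = refl
  [⊥/⊥]-id (A ∧' B)    = cong₂ _∧'_ ([⊥/⊥]-id A) ([⊥/⊥]-id B)
  [⊥/⊥]-id (A ∨' B)    = cong₂ _∨'_ ([⊥/⊥]-id A) ([⊥/⊥]-id B)
  [⊥/⊥]-id (A ⇒ B)     = cong₂ _⇒_ ([⊥/⊥]-id A) ([⊥/⊥]-id B)
  [⊥/⊥]-id (∀' A)      = cong ∀' ([⊥/⊥]-id A)
  [⊥/⊥]-id (∃' A)      = cong ∃' ([⊥/⊥]-id A)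

  [/⊥]-inst : ∀ A F t → (A [ shift F /⊥]) [ t ] ≡ (A [ t ]) [ F /⊥]
  [/⊥]-inst A F t = trans (substF-[/⊥] (single t) A (shift F)) (cong ((A [ t ]) [_/⊥]) (shift-inst t F))

  gg : Formula → Formula
  gg ⊥'          = ⊥'
  gg (atom p ts) = neg (neg (atom p ts))
  gg (A ∧' B)    = gg A ∧' gg B
  gg (A ∨' B)    = neg (neg (gg A) ∧' neg (gg B))
  gg (A ⇒ B)     = gg A ⇒ gg B
  gg (∀' A)      = ∀' (gg A)
  gg (∃' A)      = neg (∀' (neg (gg A)))

  gg-substF : ∀ σ A → gg (substF σ A) ≡ substF σ (gg A)
  gg-substF σ ⊥'          = refl
  gg-substF σ (atom p ts) = refl
  gg-substF σ (A ∧' B)    = cong₂ _∧'_ (gg-substF σ A) (gg-substF σ B)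
  gg-substF σ (A ∨' B)    = cong₂ (λ X Y → neg (neg X ∧' neg Y)) (gg-substF σ A) (gg-substF σ B)
  gg-substF σ (A ⇒ B)     = cong₂ _⇒_ (gg-substF σ A) (gg-substF σ B)
  gg-substF σ (∀' A)      = cong ∀' (gg-substF (exts σ) A)
  gg-substF σ (∃' A)      = cong (λ X → neg (∀' (neg X))) (gg-substF (exts σ) A)

  gg-NF : ∀ A → NF (gg A)
  gg-NF ⊥'          = nf⊥
  gg-NF (atom p ts) = nfAt p ts
  gg-NF (A ∧' B)    = nf∧ (gg-NF A) (gg-NF B)
  gg-NF (A ∨' B)    = nf⇒ (nf∧ (nf⇒ (gg-NF A) nf⊥) (nf⇒ (gg-NF B) nf⊥)) nf⊥
  gg-NF (A ⇒ B)     = nf⇒ (gg-NF A) (gg-NF B)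
  gg-NF (∀' A)      = nf∀ (gg-NF A)
  gg-NF (∃' A)      = nf⇒ (nf∀ (nf⇒ (gg-NF A) nf⊥)) nf⊥

  gg[_/⊥] : Formula → Formula → Formula
  gg[ F /⊥] A = gg A [ F /⊥]

  gg[/⊥]-shift : ∀ F A → gg[ shift F /⊥] (shift A) ≡ shift (gg[ F /⊥] A)
  gg[/⊥]-shift F A =
    sym (trans (substF-[/⊥] ↑ₛ (gg A) F) (cong (_[ shift F /⊥]) (sym (gg-substF ↑ₛ A))))

  gg[/⊥]-inst : ∀ F A t → (gg[ shift F /⊥] A) [ t ] ≡ gg[ F /⊥] (A [ t ])
  gg[/⊥]-inst F A t = trans ([/⊥]-inst (gg A) F t) (cong (_[ F /⊥]) (sym (gg-substF (single t) A)))

  gg[/⊥]-exFalso : ∀ {Γ} F A → IL Γ ⊢ F → IL Γ ⊢ gg[ F /⊥] A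
  gg[/⊥]-exFalso F ⊥'          d = d
  gg[/⊥]-exFalso F (atom p ts) d = ⇒I (wk d)
  gg[/⊥]-exFalso F (A ∧' B)    d = ∧I (gg[/⊥]-exFalso F A d) (gg[/⊥]-exFalso F B d)
  gg[/⊥]-exFalso F (A ∨' B)    d = ⇒I (wk d)
  gg[/⊥]-exFalso F (A ⇒ B)     d = ⇒I (gg[/⊥]-exFalso F B (wk d))
  gg[/⊥]-exFalso F (∀' A)      d = ∀I (gg[/⊥]-exFalso (shift F) A (shiftDeriv d))
  gg[/⊥]-exFalso F (∃' A)      d = ⇒I (wk d)

  ⇒-stable : ∀ {c Γ X F} → Deriv c Γ (((X ⇒ F) ⇒ F) ⇒ F) → Deriv c Γ (X ⇒ F)
  ⇒-stable h = ⇒I (⇒E (wk h) (⇒I (⇒E hyp (wk hyp))))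

  gg[/⊥]-stable : ∀ {Γ} F A → IL Γ ⊢ ((gg[ F /⊥] A ⇒ F) ⇒ F) → IL Γ ⊢ gg[ F /⊥] A
  gg[/⊥]-stable F ⊥'          h = ⇒E h (⇒I hyp)
  gg[/⊥]-stable F (atom p ts) h = ⇒-stable h
  gg[/⊥]-stable F (A ∧' B)    h =
    ∧I (gg[/⊥]-stable F A (⇒I (⇒E (wk h) (⇒I (⇒E (wk hyp) (∧E₁ hyp))))))
       (gg[/⊥]-stable F B (⇒I (⇒E (wk h) (⇒I (⇒E (wk hyp) (∧E₂ hyp))))))
  gg[/⊥]-stable F (A ∨' B)    h = ⇒-stable h
  gg[/⊥]-stable F (A ⇒ B)     h =
    ⇒I (gg[/⊥]-stable F B (⇒I (⇒E (wk (wk h)) (⇒I (⇒E (wk hyp) (⇒E hyp (wk (wk hyp))))))))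
  gg[/⊥]-stable F (∀' A)      h =
    ∀I (gg[/⊥]-stable (shift F) A (⇒I (⇒E (wk (shiftDeriv h)) (⇒I (⇒E (wk hyp) (∀E-shift₀ hyp))))))
  gg[/⊥]-stable F (∃' A)      h = ⇒-stable h

  image-↑-gg[/⊥] : ∀ F {Γ} → image gg[ shift F /⊥] (↑ Γ) ⊆ ↑ (image gg[ F /⊥] Γ)
  image-↑-gg[/⊥] F _ (_ , (C , g , refl) , refl) = gg[ F /⊥] C , (C , g , refl) , gg[/⊥]-shift F C

  -- Friedman's argument: no property of F is needed.
  gg[/⊥]-preserves : ∀ F {Γ A} → CL Γ ⊢ A → IL image gg[ F /⊥] Γ ⊢ gg[ F /⊥] A
  gg[/⊥]-preserves F (assum x)  = assum (_ , x , refl)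
  gg[/⊥]-preserves F {A = A} (⊥E d) = gg[/⊥]-exFalso F A (gg[/⊥]-preserves F d)
  gg[/⊥]-preserves F (∧I d e)   = ∧I (gg[/⊥]-preserves F d) (gg[/⊥]-preserves F e)
  gg[/⊥]-preserves F (∧E₁ d)    = ∧E₁ (gg[/⊥]-preserves F d)
  gg[/⊥]-preserves F (∧E₂ d)    = ∧E₂ (gg[/⊥]-preserves F d)
  gg[/⊥]-preserves F (∨I₁ d)    = ⇒I (⇒E (∧E₁ hyp) (wk (gg[/⊥]-preserves F d)))
  gg[/⊥]-preserves F (∨I₂ d)    = ⇒I (⇒E (∧E₂ hyp) (wk (gg[/⊥]-preserves F d)))
  gg[/⊥]-preserves F {A = C} (∨E d e f) =
    gg[/⊥]-stable F C (⇒I (⇒E (wk (gg[/⊥]-preserves F d))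
      (∧I (⇒I (⇒E (wk hyp) (weaken branch (gg[/⊥]-preserves F e))))
          (⇒I (⇒E (wk hyp) (weaken branch (gg[/⊥]-preserves F f)))))))
    where
      branch : ∀ {Γ B} → image gg[ F /⊥] (Γ ,, B) ⊆
                         ((image gg[ F /⊥] Γ ,, (gg[ F /⊥] C ⇒ F)) ,, gg[ F /⊥] B)
      branch {Γ} D = ,,-mono {Δ = image gg[ F /⊥] Γ ,, (gg[ F /⊥] C ⇒ F)} (λ _ → inj₁) D
                     ∘ image-,, gg[ F /⊥] D
  gg[/⊥]-preserves F (⇒I d)     = ⇒I (weaken (image-,, gg[ F /⊥]) (gg[/⊥]-preserves F d))
  gg[/⊥]-preserves F (⇒E d e)   = ⇒E (gg[/⊥]-preserves F d) (gg[/⊥]-preserves F e)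
  gg[/⊥]-preserves F (∀I d)     = ∀I (weaken (image-↑-gg[/⊥] F) (gg[/⊥]-preserves (shift F) d))
  gg[/⊥]-preserves F (∀E {A = A} d t) = castD (gg[/⊥]-inst F A t) (∀E (gg[/⊥]-preserves F d) t)
  gg[/⊥]-preserves F (∃I {A = A} t d) =
    ⇒I (⇒E (castD (cong₂ _⇒_ (gg[/⊥]-inst F A t) (shift-inst t F)) (∀E hyp t)) (wk (gg[/⊥]-preserves F d)))
  gg[/⊥]-preserves F (∃E {A = A} {C = C} d e) =
    gg[/⊥]-stable F C (⇒I (⇒E (wk (gg[/⊥]-preserves F d))
      (∀I (⇒I (⇒E (assum (inj₁ (_ , inj₂ refl , refl)))
                   (castD (gg[/⊥]-shift F C) (weaken witness (gg[/⊥]-preserves (shift F) e))))))))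
    where
      witness : ∀ {Γ} → image gg[ shift F /⊥] (↑ Γ ,, A) ⊆
                        (↑ (image gg[ F /⊥] Γ ,, (gg[ F /⊥] C ⇒ F)) ,, gg[ shift F /⊥] A)
      witness {Γ} D = ,,-mono (λ B → ↑-mono {Δ = image gg[ F /⊥] Γ ,, (gg[ F /⊥] C ⇒ F)} (λ _ → inj₁) B
                                       ∘ image-↑-gg[/⊥] F B) D
                      ∘ image-,, gg[ shift F /⊥] D
  gg[/⊥]-preserves F (lem x)    = ⇒I (⇒E (∧E₂ hyp) (∧E₁ hyp))

  mutual
    gg-classical⇒ : ∀ {Γ} A → CL Γ ⊢ A → CL Γ ⊢ gg A
    gg-classical⇒ ⊥'          d = d
    gg-classical⇒ (atom p ts) d = ⇒I (⇒E hyp (wk d))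
    gg-classical⇒ (A ∧' B)    d = ∧I (gg-classical⇒ A (∧E₁ d)) (gg-classical⇒ B (∧E₂ d))
    gg-classical⇒ (A ∨' B)    d =
      ⇒I (∨E (wk d) (⇒E (∧E₁ (wk hyp)) (gg-classical⇒ A hyp)) (⇒E (∧E₂ (wk hyp)) (gg-classical⇒ B hyp)))
    gg-classical⇒ (A ⇒ B)     d = ⇒I (gg-classical⇒ B (⇒E (wk d) (gg-classical⇐ A hyp)))
    gg-classical⇒ (∀' A)      d = ∀I (gg-classical⇒ A (∀E₀ d))
    gg-classical⇒ (∃' A)      d =
      ⇒I (∃E (wk d) (⇒E (∀E-shift₀ (assum (inj₁ (_ , inj₂ refl , refl)))) (gg-classical⇒ A hyp)))

    gg-classical⇐ : ∀ {Γ} A → CL Γ ⊢ gg A → CL Γ ⊢ A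
    gg-classical⇐ ⊥'          d = d
    gg-classical⇐ (atom p ts) d = ∨E (lem refl) hyp (⊥E (⇒E (wk d) hyp))
    gg-classical⇐ (A ∧' B)    d = ∧I (gg-classical⇐ A (∧E₁ d)) (gg-classical⇐ B (∧E₂ d))
    gg-classical⇐ (A ∨' B)    d =
      ∨E (lem refl) hyp (⊥E (⇒E (wk d) (∧I (⇒I (⇒E (wk hyp) (∨I₁ (gg-classical⇐ A hyp))))
                                            (⇒I (⇒E (wk hyp) (∨I₂ (gg-classical⇐ B hyp)))))))
    gg-classical⇐ (A ⇒ B)     d = ⇒I (gg-classical⇐ B (⇒E (wk d) (gg-classical⇒ A hyp)))
    gg-classical⇐ (∀' A)      d = ∀I (gg-classical⇐ A (∀E₀ d))
    gg-classical⇐ (∃' A)      d =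
      ∨E (lem refl) hyp
         (⊥E (⇒E (wk d) (∀I (⇒I (⇒E (assum (inj₁ (_ , inj₂ refl , refl)))
                                     (∃I (var zero) (castD (sym (exts-↑-inst₀ A)) (gg-classical⇐ A hyp))))))))

  gg-classEquiv : ∀ A → CL ∅ ⊢ (A ⇔' gg A)
  gg-classEquiv A = ⇔I (gg-classical⇒ A hyp) (gg-classical⇐ A hyp)

  mutual
    NF-[/⊥]⇒gg[/⊥] : ∀ {Γ A} F → NF A → IL Γ ⊢ (A [ F /⊥]) → IL Γ ⊢ gg[ F /⊥] A
    NF-[/⊥]⇒gg[/⊥] F nf⊥         d = d
    NF-[/⊥]⇒gg[/⊥] F (nfAt p ts) d = ⇒I (⇒E hyp (wk d))
    NF-[/⊥]⇒gg[/⊥] F (nf∧ a b)   d = ∧I (NF-[/⊥]⇒gg[/⊥] F a (∧E₁ d)) (NF-[/⊥]⇒gg[/⊥] F b (∧E₂ d))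
    NF-[/⊥]⇒gg[/⊥] F (nf⇒ a b)   d = ⇒I (NF-[/⊥]⇒gg[/⊥] F b (⇒E (wk d) (NF-gg[/⊥]⇒[/⊥] F a hyp)))
    NF-[/⊥]⇒gg[/⊥] F (nf∀ a)     d = ∀I (NF-[/⊥]⇒gg[/⊥] (shift F) a (∀E₀ d))

    NF-gg[/⊥]⇒[/⊥] : ∀ {Γ A} F → NF A → IL Γ ⊢ gg[ F /⊥] A → IL Γ ⊢ (A [ F /⊥])
    NF-gg[/⊥]⇒[/⊥] F nf⊥         d = d
    NF-gg[/⊥]⇒[/⊥] F (nfAt p ts) d = ⇒-stable d
    NF-gg[/⊥]⇒[/⊥] F (nf∧ a b)   d = ∧I (NF-gg[/⊥]⇒[/⊥] F a (∧E₁ d)) (NF-gg[/⊥]⇒[/⊥] F b (∧E₂ d))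
    NF-gg[/⊥]⇒[/⊥] F (nf⇒ a b)   d = ⇒I (NF-gg[/⊥]⇒[/⊥] F b (⇒E (wk d) (NF-[/⊥]⇒gg[/⊥] F a hyp)))
    NF-gg[/⊥]⇒[/⊥] F (nf∀ a)     d = ∀I (NF-gg[/⊥]⇒[/⊥] (shift F) a (∀E₀ d))

  NF-[/⊥]⇔gg[/⊥] : ∀ {A} F → NF A → IL ∅ ⊢ ((A [ F /⊥]) ⇔' gg[ F /⊥] A)
  NF-[/⊥]⇔gg[/⊥] F a = ⇔I (NF-[/⊥]⇒gg[/⊥] F a hyp) (NF-gg[/⊥]⇒[/⊥] F a hyp)

  NF⇔gg : ∀ {A} → NF A → IL ∅ ⊢ (A ⇔' gg A)
  NF⇔gg {A} a = castD (cong₂ _⇔'_ ([⊥/⊥]-id A) ([⊥/⊥]-id (gg A))) (NF-[/⊥]⇔gg[/⊥] ⊥' a)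

  gg-preserves : ∀ {Γ A} → CL Γ ⊢ A → IL image gg Γ ⊢ gg A
  gg-preserves {A = A} d =
    weaken (λ { _ (C , g , refl) → C , g , [⊥/⊥]-id (gg C) })
           (castD ([⊥/⊥]-id (gg A)) (gg[/⊥]-preserves ⊥' d))

  NF-conservative : ∀ {A} → NF A → CL ∅ ⊢ A → IL ∅ ⊢ A
  NF-conservative a d = ⇔-from (NF⇔gg a) (weaken (λ { _ (_ , () , _) }) (gg-preserves d))

  mutual
    [/⊥]-refuted⇒ : ∀ {c Γ} F A → Deriv c Γ (neg F) → Deriv c Γ A → Deriv c Γ (A [ F /⊥])
    [/⊥]-refuted⇒ F ⊥'          n d = ⊥E d
    [/⊥]-refuted⇒ F (atom p ts) n d = d
    [/⊥]-refuted⇒ F (A ∧' B)    n d = ∧I ([/⊥]-refuted⇒ F A n (∧E₁ d)) ([/⊥]-refuted⇒ F B n (∧E₂ d))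
    [/⊥]-refuted⇒ F (A ∨' B)    n d =
      ∨E d (∨I₁ ([/⊥]-refuted⇒ F A (wk n) hyp)) (∨I₂ ([/⊥]-refuted⇒ F B (wk n) hyp))
    [/⊥]-refuted⇒ F (A ⇒ B)     n d =
      ⇒I ([/⊥]-refuted⇒ F B (wk n) (⇒E (wk d) ([/⊥]-refuted⇐ F A (wk n) hyp)))
    [/⊥]-refuted⇒ F (∀' A)      n d = ∀I ([/⊥]-refuted⇒ (shift F) A (shiftDeriv n) (∀E₀ d))
    [/⊥]-refuted⇒ F (∃' A)      n d =
      ∃E d (∃I (var zero) (castD (sym (exts-↑-inst₀ _)) ([/⊥]-refuted⇒ (shift F) A (wk (shiftDeriv n)) hyp)))

    [/⊥]-refuted⇐ : ∀ {c Γ} F A → Deriv c Γ (neg F) → Deriv c Γ (A [ F /⊥]) → Deriv c Γ A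
    [/⊥]-refuted⇐ F ⊥'          n d = ⇒E n d
    [/⊥]-refuted⇐ F (atom p ts) n d = d
    [/⊥]-refuted⇐ F (A ∧' B)    n d = ∧I ([/⊥]-refuted⇐ F A n (∧E₁ d)) ([/⊥]-refuted⇐ F B n (∧E₂ d))
    [/⊥]-refuted⇐ F (A ∨' B)    n d =
      ∨E d (∨I₁ ([/⊥]-refuted⇐ F A (wk n) hyp)) (∨I₂ ([/⊥]-refuted⇐ F B (wk n) hyp))
    [/⊥]-refuted⇐ F (A ⇒ B)     n d =
      ⇒I ([/⊥]-refuted⇐ F B (wk n) (⇒E (wk d) ([/⊥]-refuted⇒ F A (wk n) hyp)))
    [/⊥]-refuted⇐ F (∀' A)      n d = ∀I ([/⊥]-refuted⇐ (shift F) A (shiftDeriv n) (∀E₀ d))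
    [/⊥]-refuted⇐ F (∃' A)      n d =
      ∃E d (∃I (var zero) (castD (sym (exts-↑-inst₀ _)) ([/⊥]-refuted⇐ (shift F) A (wk (shiftDeriv n)) hyp)))

  -- Two-valued semantics in a one-element structure where every atom has value b

  eval : Bool → Formula → Bool
  eval b ⊥'          = false
  eval b (atom p ts) = b
  eval b (A ∧' B)    = eval b A ∧ eval b B
  eval b (A ∨' B)    = eval b A ∨ eval b B
  eval b (A ⇒ B)     = not (eval b A) ∨ eval b B
  eval b (∀' A)      = eval b A
  eval b (∃' A)      = eval b A

  eval-substF : ∀ b σ A → eval b (substF σ A) ≡ eval b A
  eval-substF b σ ⊥'          = refl
  eval-substF b σ (atom p ts) = refl
  eval-substF b σ (A ∧' B)    = cong₂ _∧_ (eval-substF b σ A) (eval-substF b σ B)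
  eval-substF b σ (A ∨' B)    = cong₂ _∨_ (eval-substF b σ A) (eval-substF b σ B)
  eval-substF b σ (A ⇒ B)     = cong₂ (λ x y → not x ∨ y) (eval-substF b σ A) (eval-substF b σ B)
  eval-substF b σ (∀' A)      = eval-substF b (exts σ) A
  eval-substF b σ (∃' A)      = eval-substF b (exts σ) A

  T-⇒ : ∀ {x y} → T (not x ∨ y) ⇔ (T x → T y)
  T-⇒ {true}  = mk⇔ (λ y _ → y) (λ f → f tt)
  T-⇒ {false} = mk⇔ (λ _ ()) (λ _ → tt)

  T-excludedMiddle : ∀ x → T (x ∨ (not x ∨ false))
  T-excludedMiddle true  = tt
  T-excludedMiddle false = tt

  CL-sound-eval : ∀ {Γ A} b → CL Γ ⊢ A → (∀ B → Γ B → T (eval b B)) → T (eval b A)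
  CL-sound-eval b (assum x)  h = h _ x
  CL-sound-eval b (⊥E d)     h = ⊥-elim (CL-sound-eval b d h)
  CL-sound-eval b (∧I d e)   h = Equivalence.from T-∧ (CL-sound-eval b d h , CL-sound-eval b e h)
  CL-sound-eval b (∧E₁ d)    h = proj₁ (Equivalence.to T-∧ (CL-sound-eval b d h))
  CL-sound-eval b (∧E₂ d)    h = proj₂ (Equivalence.to T-∧ (CL-sound-eval b d h))
  CL-sound-eval b (∨I₁ d)    h = Equivalence.from T-∨ (inj₁ (CL-sound-eval b d h))
  CL-sound-eval b (∨I₂ {A = A} d) h = Equivalence.from (T-∨ {eval b A}) (inj₂ (CL-sound-eval b d h))
  CL-sound-eval b (∨E d e f) h with Equivalence.to T-∨ (CL-sound-eval b d h)
  ... | inj₁ x = CL-sound-eval b e λ { B (inj₁ y) → h B y ; B (inj₂ refl) → x }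
  ... | inj₂ x = CL-sound-eval b f λ { B (inj₁ y) → h B y ; B (inj₂ refl) → x }
  CL-sound-eval b (⇒I d)     h =
    Equivalence.from T-⇒ λ x → CL-sound-eval b d λ { B (inj₁ y) → h B y ; B (inj₂ refl) → x }
  CL-sound-eval b (⇒E d e)   h = Equivalence.to T-⇒ (CL-sound-eval b d h) (CL-sound-eval b e h)
  CL-sound-eval b (∀I d)     h =
    CL-sound-eval b d λ { B (C , g , refl) → subst T (sym (eval-substF b ↑ₛ C)) (h C g) }
  CL-sound-eval b (∀E {A = A} d t) h = subst T (sym (eval-substF b (single t) A)) (CL-sound-eval b d h)
  CL-sound-eval b (∃I {A = A} t d) h = subst T (eval-substF b (single t) A) (CL-sound-eval b d h)
  CL-sound-eval b (∃E {C = C} d e) h =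
    subst T (eval-substF b ↑ₛ C)
      (CL-sound-eval b e λ { B (inj₁ (D , g , refl)) → subst T (sym (eval-substF b ↑ₛ D)) (h D g)
                           ; B (inj₂ refl) → CL-sound-eval b d h })
  CL-sound-eval b (lem {A = A} x) h = T-excludedMiddle (eval b A)

  refuted-eval : ∀ {F} b → CL ∅ ⊢ neg F → ¬ T (eval b F)
  refuted-eval b d = Equivalence.to T-⇒ (CL-sound-eval b d λ _ ())

  ⊬-by-eval : ∀ {X A} b → T (eval b X) → ¬ T (eval b A) → ¬ (IL (∅ ,, X) ⊢ A)
  ⊬-by-eval b x a d = a (CL-sound-eval b (IL⇒CL d) λ { _ (inj₂ refl) → x })

  -- A Kripke model: worlds (ℕ, ≤), constant domain ℕ, function symbols denote 0, and
  -- an atom holds at world w iff one of its arguments is below w.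

  Env : Set
  Env = ℕ → ℕ

  ⟦_⟧ : Term → Env → ℕ
  ⟦ var x ⟧    ρ = ρ x
  ⟦ fun f ts ⟧ ρ = 0

  _∷ₑ_ : ℕ → Env → Env
  (d ∷ₑ ρ) zero    = d
  (d ∷ₑ ρ) (suc x) = ρ x

  ForcesAtom : ∀ {n} → ℕ → Env → Vec Term n → Set
  ForcesAtom w ρ []       = ⊥
  ForcesAtom w ρ (t ∷ ts) = ⟦ t ⟧ ρ < w ⊎ ForcesAtom w ρ ts

  Forces : ℕ → Env → Formula → Set
  Forces w ρ ⊥'          = ⊥
  Forces w ρ (atom p ts) = ForcesAtom w ρ ts
  Forces w ρ (A ∧' B)    = Forces w ρ A × Forces w ρ B
  Forces w ρ (A ∨' B)    = Forces w ρ A ⊎ Forces w ρ B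
  Forces w ρ (A ⇒ B)     = ∀ v → w ≤ v → Forces v ρ A → Forces v ρ B
  Forces w ρ (∀' A)      = ∀ v → w ≤ v → ∀ d → Forces v (d ∷ₑ ρ) A
  Forces w ρ (∃' A)      = Σ ℕ λ d → Forces w (d ∷ₑ ρ) A

  ForcesAtom-mono : ∀ {n w v ρ} → w ≤ v → (ts : Vec Term n) → ForcesAtom w ρ ts → ForcesAtom v ρ ts
  ForcesAtom-mono w≤v (t ∷ ts) (inj₁ t<w) = inj₁ (<-≤-trans t<w w≤v)
  ForcesAtom-mono w≤v (t ∷ ts) (inj₂ f)   = inj₂ (ForcesAtom-mono w≤v ts f)

  Forces-mono : ∀ {w v ρ} A → w ≤ v → Forces w ρ A → Forces v ρ A
  Forces-mono (atom p ts) w≤v f       = ForcesAtom-mono w≤v ts f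
  Forces-mono (A ∧' B)    w≤v (a , b) = Forces-mono A w≤v a , Forces-mono B w≤v b
  Forces-mono (A ∨' B)    w≤v (inj₁ a) = inj₁ (Forces-mono A w≤v a)
  Forces-mono (A ∨' B)    w≤v (inj₂ b) = inj₂ (Forces-mono B w≤v b)
  Forces-mono (A ⇒ B)     w≤v f       = λ u v≤u → f u (≤-trans w≤v v≤u)
  Forces-mono (∀' A)      w≤v f       = λ u v≤u → f u (≤-trans w≤v v≤u)
  Forces-mono (∃' A)      w≤v (d , a) = d , Forces-mono A w≤v a

  ⟦⟧-cong : ∀ {ρ ρ′} → ρ ≗ ρ′ → ∀ t → ⟦ t ⟧ ρ ≡ ⟦ t ⟧ ρ′
  ⟦⟧-cong e (var x)    = e x
  ⟦⟧-cong e (fun f ts) = refl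

  ∷ₑ-cong : ∀ {ρ ρ′} d → ρ ≗ ρ′ → d ∷ₑ ρ ≗ d ∷ₑ ρ′
  ∷ₑ-cong d e zero    = refl
  ∷ₑ-cong d e (suc x) = e x

  ForcesAtom-cong : ∀ {n w ρ ρ′} → ρ ≗ ρ′ → (ts : Vec Term n) → ForcesAtom w ρ ts → ForcesAtom w ρ′ ts
  ForcesAtom-cong e (t ∷ ts) (inj₁ t<w) = inj₁ (subst (_< _) (⟦⟧-cong e t) t<w)
  ForcesAtom-cong e (t ∷ ts) (inj₂ f)   = inj₂ (ForcesAtom-cong e ts f)

  Forces-cong : ∀ {w ρ ρ′} → ρ ≗ ρ′ → ∀ A → Forces w ρ A → Forces w ρ′ A
  Forces-cong e (atom p ts) f        = ForcesAtom-cong e ts f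
  Forces-cong e (A ∧' B)    (a , b)  = Forces-cong e A a , Forces-cong e B b
  Forces-cong e (A ∨' B)    (inj₁ a) = inj₁ (Forces-cong e A a)
  Forces-cong e (A ∨' B)    (inj₂ b) = inj₂ (Forces-cong e B b)
  Forces-cong e (A ⇒ B)     f        = λ v w≤v a → Forces-cong e B (f v w≤v (Forces-cong (sym ∘ e) A a))
  Forces-cong e (∀' A)      f        = λ v w≤v d → Forces-cong (∷ₑ-cong d e) A (f v w≤v d)
  Forces-cong e (∃' A)      (d , a)  = d , Forces-cong (∷ₑ-cong d e) A a

  ⟦_⟧ₛ : Subst → Env → Env
  ⟦ σ ⟧ₛ ρ x = ⟦ σ x ⟧ ρ

  ⟦substT⟧ : ∀ σ ρ t → ⟦ substT σ t ⟧ ρ ≡ ⟦ t ⟧ (⟦ σ ⟧ₛ ρ)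
  ⟦substT⟧ σ ρ (var x)    = refl
  ⟦substT⟧ σ ρ (fun f ts) = refl

  ⟦exts⟧ : ∀ σ ρ d → ⟦ exts σ ⟧ₛ (d ∷ₑ ρ) ≗ d ∷ₑ ⟦ σ ⟧ₛ ρ
  ⟦exts⟧ σ ρ d zero    = refl
  ⟦exts⟧ σ ρ d (suc x) = ⟦substT⟧ ↑ₛ (d ∷ₑ ρ) (σ x)

  ⟦single⟧ : ∀ t ρ → ⟦ single t ⟧ₛ ρ ≗ ⟦ t ⟧ ρ ∷ₑ ρ
  ⟦single⟧ t ρ zero    = refl
  ⟦single⟧ t ρ (suc x) = refl

  ForcesAtom-substTs : ∀ {n w} σ ρ (ts : Vec Term n) →
                       ForcesAtom w ρ (substTs σ ts) ⇔ ForcesAtom w (⟦ σ ⟧ₛ ρ) ts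
  ForcesAtom-substTs σ ρ ts = mk⇔ (to ts) (from ts)
    where
      to : ∀ {n w} (ts : Vec Term n) → ForcesAtom w ρ (substTs σ ts) → ForcesAtom w (⟦ σ ⟧ₛ ρ) ts
      to (t ∷ ts) (inj₁ t<w) = inj₁ (subst (_< _) (⟦substT⟧ σ ρ t) t<w)
      to (t ∷ ts) (inj₂ f)   = inj₂ (to ts f)
      from : ∀ {n w} (ts : Vec Term n) → ForcesAtom w (⟦ σ ⟧ₛ ρ) ts → ForcesAtom w ρ (substTs σ ts)
      from (t ∷ ts) (inj₁ t<w) = inj₁ (subst (_< _) (sym (⟦substT⟧ σ ρ t)) t<w)
      from (t ∷ ts) (inj₂ f)   = inj₂ (from ts f)

  mutual
    Forces-substF : ∀ {w} σ ρ A → Forces w ρ (substF σ A) → Forces w (⟦ σ ⟧ₛ ρ) A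
    Forces-substF σ ρ (atom p ts) f = Equivalence.to (ForcesAtom-substTs σ ρ ts) f
    Forces-substF σ ρ (A ∧' B) (a , b) = Forces-substF σ ρ A a , Forces-substF σ ρ B b
    Forces-substF σ ρ (A ∨' B) (inj₁ a) = inj₁ (Forces-substF σ ρ A a)
    Forces-substF σ ρ (A ∨' B) (inj₂ b) = inj₂ (Forces-substF σ ρ B b)
    Forces-substF σ ρ (A ⇒ B) f = λ v w≤v a → Forces-substF σ ρ B (f v w≤v (Forces-substF⁻ σ ρ A a))
    Forces-substF σ ρ (∀' A) f =
      λ v w≤v d → Forces-cong (⟦exts⟧ σ ρ d) A (Forces-substF (exts σ) (d ∷ₑ ρ) A (f v w≤v d))
    Forces-substF σ ρ (∃' A) (d , a) = d , Forces-cong (⟦exts⟧ σ ρ d) A (Forces-substF (exts σ) (d ∷ₑ ρ) A a)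

    Forces-substF⁻ : ∀ {w} σ ρ A → Forces w (⟦ σ ⟧ₛ ρ) A → Forces w ρ (substF σ A)
    Forces-substF⁻ σ ρ (atom p ts) f = Equivalence.from (ForcesAtom-substTs σ ρ ts) f
    Forces-substF⁻ σ ρ (A ∧' B) (a , b) = Forces-substF⁻ σ ρ A a , Forces-substF⁻ σ ρ B b
    Forces-substF⁻ σ ρ (A ∨' B) (inj₁ a) = inj₁ (Forces-substF⁻ σ ρ A a)
    Forces-substF⁻ σ ρ (A ∨' B) (inj₂ b) = inj₂ (Forces-substF⁻ σ ρ B b)
    Forces-substF⁻ σ ρ (A ⇒ B) f = λ v w≤v a → Forces-substF⁻ σ ρ B (f v w≤v (Forces-substF σ ρ A a))
    Forces-substF⁻ σ ρ (∀' A) f =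
      λ v w≤v d → Forces-substF⁻ (exts σ) (d ∷ₑ ρ) A (Forces-cong (sym ∘ ⟦exts⟧ σ ρ d) A (f v w≤v d))
    Forces-substF⁻ σ ρ (∃' A) (d , a) =
      d , Forces-substF⁻ (exts σ) (d ∷ₑ ρ) A (Forces-cong (sym ∘ ⟦exts⟧ σ ρ d) A a)

  IL-sound-Forces : ∀ {Γ A} → IL Γ ⊢ A → ∀ w ρ → (∀ B → Γ B → Forces w ρ B) → Forces w ρ A
  IL-sound-Forces (assum x)  w ρ h = h _ x
  IL-sound-Forces (⊥E d)     w ρ h = ⊥-elim (IL-sound-Forces d w ρ h)
  IL-sound-Forces (∧I d e)   w ρ h = IL-sound-Forces d w ρ h , IL-sound-Forces e w ρ h
  IL-sound-Forces (∧E₁ d)    w ρ h = proj₁ (IL-sound-Forces d w ρ h)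
  IL-sound-Forces (∧E₂ d)    w ρ h = proj₂ (IL-sound-Forces d w ρ h)
  IL-sound-Forces (∨I₁ d)    w ρ h = inj₁ (IL-sound-Forces d w ρ h)
  IL-sound-Forces (∨I₂ d)    w ρ h = inj₂ (IL-sound-Forces d w ρ h)
  IL-sound-Forces (∨E d e f) w ρ h with IL-sound-Forces d w ρ h
  ... | inj₁ x = IL-sound-Forces e w ρ λ { B (inj₁ y) → h B y ; B (inj₂ refl) → x }
  ... | inj₂ x = IL-sound-Forces f w ρ λ { B (inj₁ y) → h B y ; B (inj₂ refl) → x }
  IL-sound-Forces (⇒I d)     w ρ h =
    λ v w≤v a → IL-sound-Forces d v ρ λ { B (inj₁ y) → Forces-mono B w≤v (h B y) ; B (inj₂ refl) → a }
  IL-sound-Forces (⇒E d e)   w ρ h = IL-sound-Forces d w ρ h w ≤-refl (IL-sound-Forces e w ρ h)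
  IL-sound-Forces (∀I d)     w ρ h =
    λ v w≤v e → IL-sound-Forces d v (e ∷ₑ ρ)
      λ { B (C , g , refl) → Forces-substF⁻ ↑ₛ (e ∷ₑ ρ) C (Forces-mono C w≤v (h C g)) }
  IL-sound-Forces (∀E {A = A} d t) w ρ h =
    Forces-substF⁻ (single t) ρ A
      (Forces-cong (sym ∘ ⟦single⟧ t ρ) A (IL-sound-Forces d w ρ h w ≤-refl (⟦ t ⟧ ρ)))
  IL-sound-Forces (∃I {A = A} t d) w ρ h =
    ⟦ t ⟧ ρ , Forces-cong (⟦single⟧ t ρ) A (Forces-substF (single t) ρ A (IL-sound-Forces d w ρ h))
  IL-sound-Forces (∃E {C = C} d e) w ρ h with IL-sound-Forces d w ρ h
  ... | x , a = Forces-substF ↑ₛ (x ∷ₑ ρ) C (IL-sound-Forces e w (x ∷ₑ ρ)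
                  λ { B (inj₁ (D , g , refl)) → Forces-substF⁻ ↑ₛ (x ∷ₑ ρ) D (h D g) ; B (inj₂ refl) → a })
  IL-sound-Forces (lem ())

  -- Kleene's slash Θ ∣ Aσ, in the variant that also demands provability at ∨, ⇒, ∀ and ∃

  module Slash (Θ : FSet) where

    Slashes : Subst → Formula → Set₁
    Slashes σ ⊥'          = Lift _ ⊥
    Slashes σ (atom p ts) = IL Θ ⊢ substF σ (atom p ts)
    Slashes σ (A ∧' B)    = Slashes σ A × Slashes σ B
    Slashes σ (A ∨' B)    = (IL Θ ⊢ substF σ A × Slashes σ A) ⊎ (IL Θ ⊢ substF σ B × Slashes σ B)
    Slashes σ (A ⇒ B)     = IL Θ ⊢ substF σ (A ⇒ B) × (Slashes σ A → Slashes σ B)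
    Slashes σ (∀' A)      = IL Θ ⊢ substF σ (∀' A) × ((t : Term) → Slashes (t ∷ₛ σ) A)
    Slashes σ (∃' A)      = Σ Term λ t → IL Θ ⊢ substF (t ∷ₛ σ) A × Slashes (t ∷ₛ σ) A

    Slashes⇒⊢ : ∀ σ A → Slashes σ A → IL Θ ⊢ substF σ A
    Slashes⇒⊢ σ (atom p ts) s                = s
    Slashes⇒⊢ σ (A ∧' B)    (a , b)          = ∧I (Slashes⇒⊢ σ A a) (Slashes⇒⊢ σ B b)
    Slashes⇒⊢ σ (A ∨' B)    (inj₁ (p , _))   = ∨I₁ p
    Slashes⇒⊢ σ (A ∨' B)    (inj₂ (p , _))   = ∨I₂ p
    Slashes⇒⊢ σ (A ⇒ B)     (p , _)          = p
    Slashes⇒⊢ σ (∀' A)      (p , _)          = p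
    Slashes⇒⊢ σ (∃' A)      (t , p , _)      = ∃I t (castD (sym (exts-inst σ A t)) p)

    Slashes-cong : ∀ {σ τ} → σ ≗ τ → ∀ A → Slashes σ A → Slashes τ A
    Slashes-cong e ⊥'          s = s
    Slashes-cong e (atom p ts) s = castD (substF-cong e (atom p ts)) s
    Slashes-cong e (A ∧' B) (a , b) = Slashes-cong e A a , Slashes-cong e B b
    Slashes-cong e (A ∨' B) (inj₁ (p , a)) = inj₁ (castD (substF-cong e A) p , Slashes-cong e A a)
    Slashes-cong e (A ∨' B) (inj₂ (p , b)) = inj₂ (castD (substF-cong e B) p , Slashes-cong e B b)
    Slashes-cong e (A ⇒ B) (p , f) =
      castD (substF-cong e (A ⇒ B)) p , Slashes-cong e B ∘ f ∘ Slashes-cong (sym ∘ e) A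
    Slashes-cong e (∀' A) (p , f) =
      castD (substF-cong e (∀' A)) p , λ t → Slashes-cong (∷ₛ-cong t e) A (f t)
    Slashes-cong e (∃' A) (t , p , a) =
      t , castD (substF-cong (∷ₛ-cong t e) A) p , Slashes-cong (∷ₛ-cong t e) A a

    ∷ₛ-substF : ∀ t σ τ A → substF (t ∷ₛ σ) (substF (exts τ) A) ≡ substF (t ∷ₛ (σ ⊙ τ)) A
    ∷ₛ-substF t σ τ A = trans (substF-⊙ (t ∷ₛ σ) (exts τ) A) (substF-cong (∷ₛ-⊙-exts t σ τ) A)

    mutual
      Slashes-substF : ∀ σ τ A → Slashes σ (substF τ A) → Slashes (σ ⊙ τ) A
      Slashes-substF σ τ ⊥'          s = s
      Slashes-substF σ τ (atom p ts) s = castD (substF-⊙ σ τ (atom p ts)) s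
      Slashes-substF σ τ (A ∧' B) (a , b) = Slashes-substF σ τ A a , Slashes-substF σ τ B b
      Slashes-substF σ τ (A ∨' B) (inj₁ (p , a)) = inj₁ (castD (substF-⊙ σ τ A) p , Slashes-substF σ τ A a)
      Slashes-substF σ τ (A ∨' B) (inj₂ (p , b)) = inj₂ (castD (substF-⊙ σ τ B) p , Slashes-substF σ τ B b)
      Slashes-substF σ τ (A ⇒ B) (p , f) =
        castD (substF-⊙ σ τ (A ⇒ B)) p , Slashes-substF σ τ B ∘ f ∘ Slashes-substF⁻ σ τ A
      Slashes-substF σ τ (∀' A) (p , f) =
        castD (substF-⊙ σ τ (∀' A)) p ,
        λ t → Slashes-cong (∷ₛ-⊙-exts t σ τ) A (Slashes-substF (t ∷ₛ σ) (exts τ) A (f t))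
      Slashes-substF σ τ (∃' A) (t , p , a) =
        t , castD (∷ₛ-substF t σ τ A) p ,
        Slashes-cong (∷ₛ-⊙-exts t σ τ) A (Slashes-substF (t ∷ₛ σ) (exts τ) A a)

      Slashes-substF⁻ : ∀ σ τ A → Slashes (σ ⊙ τ) A → Slashes σ (substF τ A)
      Slashes-substF⁻ σ τ ⊥'          s = s
      Slashes-substF⁻ σ τ (atom p ts) s = castD (sym (substF-⊙ σ τ (atom p ts))) s
      Slashes-substF⁻ σ τ (A ∧' B) (a , b) = Slashes-substF⁻ σ τ A a , Slashes-substF⁻ σ τ B b
      Slashes-substF⁻ σ τ (A ∨' B) (inj₁ (p , a)) =
        inj₁ (castD (sym (substF-⊙ σ τ A)) p , Slashes-substF⁻ σ τ A a)
      Slashes-substF⁻ σ τ (A ∨' B) (inj₂ (p , b)) =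
        inj₂ (castD (sym (substF-⊙ σ τ B)) p , Slashes-substF⁻ σ τ B b)
      Slashes-substF⁻ σ τ (A ⇒ B) (p , f) =
        castD (sym (substF-⊙ σ τ (A ⇒ B))) p , Slashes-substF⁻ σ τ B ∘ f ∘ Slashes-substF σ τ A
      Slashes-substF⁻ σ τ (∀' A) (p , f) =
        castD (sym (substF-⊙ σ τ (∀' A))) p ,
        λ t → Slashes-substF⁻ (t ∷ₛ σ) (exts τ) A (Slashes-cong (sym ∘ ∷ₛ-⊙-exts t σ τ) A (f t))
      Slashes-substF⁻ σ τ (∃' A) (t , p , a) =
        t , castD (sym (∷ₛ-substF t σ τ A)) p ,
        Slashes-substF⁻ (t ∷ₛ σ) (exts τ) A (Slashes-cong (sym ∘ ∷ₛ-⊙-exts t σ τ) A a)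

    SlashesAll : FSet → Subst → Set₁
    SlashesAll Δ σ = ∀ D → Δ D → Slashes σ D

    SlashesAll-,, : ∀ {Δ σ A} → SlashesAll Δ σ → Slashes σ A → SlashesAll (Δ ,, A) σ
    SlashesAll-,, h s B (inj₁ x)    = h B x
    SlashesAll-,, h s B (inj₂ refl) = s

    SlashesAll-↑ : ∀ {Δ σ} t → SlashesAll Δ σ → SlashesAll (↑ Δ) (t ∷ₛ σ)
    SlashesAll-↑ {σ = σ} t h B (C , g , refl) = Slashes-substF⁻ (t ∷ₛ σ) ↑ₛ C (h C g)

    ⊢-substF-slashed : ∀ {Δ A} σ → IL Δ ⊢ A → SlashesAll Δ σ → IL Θ ⊢ substF σ A
    ⊢-substF-slashed σ d h = cut (substDeriv σ d) λ { B (D , g , refl) → Slashes⇒⊢ σ D (h D g) }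

    slash-sound : ∀ {Δ A} → IL Δ ⊢ A → ∀ σ → SlashesAll Δ σ → Slashes σ A
    slash-sound (assum x)  σ h = h _ x
    slash-sound (⊥E d)     σ h with slash-sound d σ h
    ... | ()
    slash-sound (∧I d e)   σ h = slash-sound d σ h , slash-sound e σ h
    slash-sound (∧E₁ d)    σ h = proj₁ (slash-sound d σ h)
    slash-sound (∧E₂ d)    σ h = proj₂ (slash-sound d σ h)
    slash-sound (∨I₁ d)    σ h = inj₁ (⊢-substF-slashed σ d h , slash-sound d σ h)
    slash-sound (∨I₂ d)    σ h = inj₂ (⊢-substF-slashed σ d h , slash-sound d σ h)
    slash-sound (∨E d e f) σ h with slash-sound d σ h
    ... | inj₁ (_ , a) = slash-sound e σ (SlashesAll-,, h a)
    ... | inj₂ (_ , b) = slash-sound f σ (SlashesAll-,, h b)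
    slash-sound (⇒I d)     σ h = ⊢-substF-slashed σ (⇒I d) h , λ a → slash-sound d σ (SlashesAll-,, h a)
    slash-sound (⇒E d e)   σ h = proj₂ (slash-sound d σ h) (slash-sound e σ h)
    slash-sound (∀I d)     σ h = ⊢-substF-slashed σ (∀I d) h , λ t → slash-sound d (t ∷ₛ σ) (SlashesAll-↑ t h)
    slash-sound (∀E {A = A} d t) σ h =
      Slashes-substF⁻ σ (single t) A
        (Slashes-cong (sym ∘ single-⊙ σ t) A (proj₂ (slash-sound d σ h) (substT σ t)))
    slash-sound (∃I {A = A} t d) σ h = substT σ t , Slashes⇒⊢ _ A s , s
      where
        s : Slashes (substT σ t ∷ₛ σ) A
        s = Slashes-cong (single-⊙ σ t) A (Slashes-substF σ (single t) A (slash-sound d σ h))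
    slash-sound (∃E {C = C} d e) σ h with slash-sound d σ h
    ... | t , _ , a =
      Slashes-substF (t ∷ₛ σ) ↑ₛ C (slash-sound e (t ∷ₛ σ) (SlashesAll-,, (SlashesAll-↑ t h) a))
    slash-sound (lem ())

    disjunctionProperty : ∀ {A B} → SlashesAll Θ var → IL Θ ⊢ (A ∨' B) → IL Θ ⊢ A ⊎ IL Θ ⊢ B
    disjunctionProperty {A} {B} h d with slash-sound d var h
    ... | inj₁ (p , _) = inj₁ (castD (substF-id A) p)
    ... | inj₂ (p , _) = inj₂ (castD (substF-id B) p)

    ⇒-slashed : ∀ {A B} → IL Θ ⊢ (A ⇒ B) → ¬ (IL Θ ⊢ A) → Slashes var (A ⇒ B)
    ⇒-slashed {A} {B} d ⊬A =
      castD (sym (substF-id (A ⇒ B))) d , λ s → ⊥-elim (⊬A (castD (substF-id A) (Slashes⇒⊢ var A s)))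

  copyOfCL : ∀ {S N} → NegativeTranslation N →
             (∀ A → S A → Σ Formula λ C → IL ∅ ⊢ (A ⇔' N C)) → (∀ C → S (N C)) → IsCopyOfCL S
  copyOfCL {N = N} t S⊆imN imN⊆S =
    N , t ,
    (λ A a → let C , e = S⊆imN A a in N C , (C , refl) , e) ,
    (λ { _ (C , refl) → N C , imN⊆S C , ⇔-refl })

  gg-negativeTranslation : NegativeTranslation gg
  gg-negativeTranslation = record { preserves = λ _ _ → gg-preserves ; classEquiv = gg-classEquiv }

  gg∨ : Formula → Formula → Formula
  gg∨ F A = gg A ∨' F

  gg∨-negativeTranslation : ∀ {F} → CL ∅ ⊢ neg F → NegativeTranslation (gg∨ F)
  gg∨-negativeTranslation {F} ⊢¬F = record
    { preserves  = λ _ _ d → weaken (λ { _ (_ , (C , g , refl) , refl) → C , g , refl })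
                                    (∨ʳ-hyps F (gg-preserves d))
    ; classEquiv = λ A → ⇔I (∨I₁ (gg-classical⇒ A hyp))
                            (∨E hyp (gg-classical⇐ A hyp) (⊥E (⇒E (weaken-∅ ⊢¬F) hyp)))
    }

  gg[/⊥]-negativeTranslation : ∀ {F} → CL ∅ ⊢ neg F → NegativeTranslation gg[ F /⊥]
  gg[/⊥]-negativeTranslation {F} ⊢¬F = record
    { preserves  = λ _ _ → gg[/⊥]-preserves F
    ; classEquiv = λ A → ⇔I ([/⊥]-refuted⇒ F (gg A) (weaken-∅ ⊢¬F) (gg-classical⇒ A hyp))
                            (gg-classical⇐ A ([/⊥]-refuted⇐ F (gg A) (weaken-∅ ⊢¬F) hyp))
    }

  NF-copy : IsCopyOfCL NF
  NF-copy = copyOfCL gg-negativeTranslation (λ A a → A , NF⇔gg a) gg-NF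

  NF∨-copy : ∀ {F} → CL ∅ ⊢ neg F → IsCopyOfCL (NF∨ F)
  NF∨-copy ⊢¬F =
    copyOfCL (gg∨-negativeTranslation ⊢¬F) (λ { _ (A , a , refl) → A , ∨-congʳ (NF⇔gg a) })
             (λ C → gg C , gg-NF C , refl)

  NF[/⊥]-copy : ∀ {F} → CL ∅ ⊢ neg F → IsCopyOfCL NF[ F /⊥]
  NF[/⊥]-copy {F} ⊢¬F =
    copyOfCL (gg[/⊥]-negativeTranslation ⊢¬F) (λ { _ (A , a , refl) → A , NF-[/⊥]⇔gg[/⊥] F a })
             (λ C → gg C , gg-NF C , refl)

  NF≉NF∨ : ∀ {F} → ¬ (IL ∅ ⊢ neg F) → ¬ (NF ≈IL NF∨ F)
  NF≉NF∨ ⊬¬F (NF⊆ , _) with NF⊆ ⊥' nf⊥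
  ... | _ , (A , a , refl) , e = ⊬¬F (⇒I (⇔-from e (∨I₂ hyp)))

  NF≉NF[/⊥] : ∀ {F} → CL ∅ ⊢ neg F → ¬ (IL ∅ ⊢ neg F) → ¬ (NF ≈IL NF[ F /⊥])
  NF≉NF[/⊥] ⊢¬F ⊬¬F (_ , ⊆NF) with ⊆NF _ (⊥' , nf⊥ , refl)
  ... | A , a , e = ⊬¬F (⇒I (⇒E (weaken-∅ ⊢¬A) (⇔-from e hyp)))
    where
      ⊢¬A : IL ∅ ⊢ neg A
      ⊢¬A = NF-conservative (nf⇒ a nf⊥) (⇒I (⇒E (weaken-∅ ⊢¬F) (⇔-to (IL⇒CL e) hyp)))

  NF∨-match : ∀ {F S X} → NF∨ F ≈IL S → S X → Σ Formula λ A → NF A × IL ∅ ⊢ ((A ∨' F) ⇔' X)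
  NF∨-match (_ , ⊆NF∨) x with ⊆NF∨ _ x
  ... | _ , (A , a , refl) , e = A , a , e

  disjunct-from-F : ∀ {A Y F} b → ¬ T (eval b Y) → ¬ T (eval b F) →
                    IL ∅ ⊢ ((A ∨' F) ⇔' (Y ⇒ F)) → IL (∅ ,, F) ⊢ A
  disjunct-from-F {A} {Y} {F} b ⊭Y ⊭F e =
    [ (λ ⊢A → cut ⊢A λ { _ (inj₂ refl) → ⇒I (wk hyp) }) , ⊥-elim ∘ ⊬-by-eval b ⊨Y⇒F ⊭F ]
      (disjunctionProperty selfSlashing (⇔-from e hyp))
    where
      open Slash (∅ ,, (Y ⇒ F))
      ⊨Y⇒F : T (eval b (Y ⇒ F))
      ⊨Y⇒F = Equivalence.from T-⇒ (⊥-elim ∘ ⊭Y)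
      selfSlashing : SlashesAll (∅ ,, (Y ⇒ F)) var
      selfSlashing _ (inj₂ refl) = ⇒-slashed hyp (⊬-by-eval b ⊨Y⇒F ⊭Y)

  -- X₂ = ¬¬q and X₁ = ¬¬¬q (with F for ⊥) would be equivalent to A₂ ∨ F and A₁ ∨ F.
  -- By the disjunction property of the self-slashing theories {Xᵢ}, F ⊢ A₁ ∧ A₂; but X₁
  -- and X₂ are contradictory, so the negative formula ¬(A₁ ∧ A₂) is classically, hence
  -- intuitionistically, valid.
  NF∨≉NF[/⊥] : ∀ {F} p ts → CL ∅ ⊢ neg F → ¬ (IL ∅ ⊢ neg F) → ¬ (NF∨ F ≈IL NF[ F /⊥])
  NF∨≉NF[/⊥] {F} p ts ⊢¬F ⊬¬F eq
    with NF∨-match eq (neg (neg (neg (atom p ts))) , nf⇒ (nfAt p ts) nf⊥ , refl)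
       | NF∨-match eq (neg (neg (atom p ts)) , nfAt p ts , refl)
  ... | A₁ , a₁ , e₁ | A₂ , a₂ , e₂ = ⊬¬F (⇒I (⇒E (weaken-∅ ⊢¬A₁∧A₂) (∧I F⊢A₁ F⊢A₂)))
    where
      ⊭F : ∀ b → ¬ T (eval b F)
      ⊭F b = refuted-eval b ⊢¬F

      F⊢A₁ : IL (∅ ,, F) ⊢ A₁
      F⊢A₁ = disjunct-from-F false (λ x₂ → ⊭F false (Equivalence.to T-⇒ x₂ tt)) (⊭F false) e₁

      F⊢A₂ : IL (∅ ,, F) ⊢ A₂
      F⊢A₂ = disjunct-from-F true (λ y → ⊭F true (Equivalence.to T-⇒ y tt)) (⊭F true) e₂

      A₁∧A₂⊢F : IL (∅ ,, (A₁ ∧' A₂)) ⊢ F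
      A₁∧A₂⊢F = ⇒E (⇔-to e₁ (∨I₁ (∧E₁ hyp))) (⇔-to e₂ (∨I₁ (∧E₂ hyp)))

      ⊢¬A₁∧A₂ : IL ∅ ⊢ neg (A₁ ∧' A₂)
      ⊢¬A₁∧A₂ = NF-conservative (nf⇒ (nf∧ a₁ a₂) nf⊥) (⇒I (⇒E (weaken-∅ ⊢¬F) (IL⇒CL A₁∧A₂⊢F)))

  ForcesAtom-unary : ∀ {n w ρ} (e : n ≡ 1) →
                     ForcesAtom w ρ (subst (Vec Term) (sym e) (var zero ∷ [])) ⇔ ρ zero < w
  ForcesAtom-unary refl = mk⇔ (λ { (inj₁ x<w) → x<w ; (inj₂ ()) }) inj₁

  CL-refutable-not-IL-refutable : ∀ {P} → relAr P ≡ 1 → Σ Formula λ F → (CL ∅ ⊢ neg F) × ¬ (IL ∅ ⊢ neg F)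
  CL-refutable-not-IL-refutable {P} e =
    neg (∀' (Px ∨' neg Px)) , ⇒I (⇒E hyp (∀I (lem refl))) ,
    λ d → IL-sound-Forces d 0 (λ _ → 0) (λ _ ()) 0 z≤n forced
    where
      Px : Formula
      Px = atom P (subst (Vec Term) (sym e) (var zero ∷ []))
      -- at world v the element v is not yet in P, but enters P at world v + 1
      forced : Forces 0 (λ _ → 0) (neg (∀' (Px ∨' neg Px)))
      forced v _ lem-v with lem-v v ≤-refl v
      ... | inj₁ v<v = <-irrefl refl (Equivalence.to (ForcesAtom-unary e) v<v)
      ... | inj₂ ¬Pv = ¬Pv (suc v) (n≤1+n v) (Equivalence.from (ForcesAtom-unary e) (n<1+n v))

mainTheorem1 : (L : Language) →
    (∃ λ P → Language.relAr L P ≡ 1) →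
    (∃ λ Q → Language.relAr L Q ≡ 0) →
    let open FOL L in
    (Σ Formula λ F → (CL ∅ ⊢ neg F) × ¬ (IL ∅ ⊢ neg F))
    × (∀ (F : Formula) → CL ∅ ⊢ neg F → ¬ (IL ∅ ⊢ neg F) →
    IsCopyOfCL NF × IsCopyOfCL (NF∨ F) × IsCopyOfCL NF[ F /⊥]
    × ¬ (NF ≈IL NF∨ F) × ¬ (NF ≈IL NF[ F /⊥]) × ¬ (NF∨ F ≈IL NF[ F /⊥]))
mainTheorem1 L (_ , unary) (Q , nullary) =
  CL-refutable-not-IL-refutable L unary ,
  λ F ⊢¬F ⊬¬F →
    NF-copy L , NF∨-copy L ⊢¬F , NF[/⊥]-copy L ⊢¬F ,
    NF≉NF∨ L ⊬¬F , NF≉NF[/⊥] L ⊢¬F ⊬¬F ,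
    NF∨≉NF[/⊥] L Q (subst (Vec (FOL.Term L)) (sym nullary) []) ⊢¬F ⊬¬F
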